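{- Let $G=(V,E)$ be a connected, undirected, unweighted graph, $R\subseteq V$ a set of landmarks and $H=(R,\delta_H)$ the highway. The labelling $L$ constructed by Algorithm 1 (described in the context) satisfies the highway cover property over $(G,H)$.
   Context: $d_G(u,v)$ denotes the shortest-path distance in $G$. A vertex $x$ lies on a shortest path between $u$ and $w$ if $d_G(u,x)+d_G(x,w)=d_G(u,w)$. A highway is a pair $H=(R,\delta_H)$ with $\delta_H(r_1,r_2)=d_G(r_1,r_2)$ for all $r_1,r_2\in R$. A distance labelling assigns to each $v\in V\setminus R$ a label $L(v)$, a set of entries $(r,\delta_L(r,v))$ with $r\in R$ and $\delta_L(r,v)=d_G(r,v)$. $L$ satisfies the highway cover property over $(G,H)$ if for all $s,t\in V\setminus R$ (not necessarily distinct) and every $r\in R$ there exist $(r_i,\delta_L(r_i,s))\in L(s)$ and $(r_j,\delta_L(r_j,t))\in L(t)$ such that $r_i$ lies on a shortest path between $r$ and $s$ and $r_j$ lies on a shortest path between $r$ and $t$ (possibly $r_i=r$ or $r_j=r$). Algorithm 1: initialise $L(v)=\emptyset$ for all $v\in V\setminus R$. For each $r_i\in R$ (in any order) run the following pruned BFS, in which each vertex is visited at most once and the root $r_i$ is visited at depth $0$. Keep two queues $\mathcal{Q}_{label}=\{r_i\}$ and $\mathcal{Q}_{prune}=\emptyset$ and set $n=0$. While $\mathcal{Q}_{label}$ contains vertices of depth $n$: (i) for each $u\in\mathcal{Q}_{label}$ at depth $n$ and each unvisited neighbour $v$ of $u$ (which becomes visited at depth $n+1$): if $v\in R$, enqueue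 $v$ to $\mathcal{Q}_{prune}$; otherwise enqueue $v$ to $\mathcal{Q}_{label}$ and add $(r_i,n+1)$ to $L(v)$; (ii) set $n\gets n+1$; (iii) for each $v\in\mathcal{Q}_{prune}$ at depth $n$, mark every unvisited neighbour of $v$ as visited at depth $n+1$ and enqueue it to $\mathcal{Q}_{prune}$ (no label is added). The output is $L$. -}

module Defs where

open import Data.Nat using (ℕ; zero; suc; _+_; _≤_; _≡ᵇ_)
open import Data.Fin using (Fin; toℕ)
open import Data.Bool using (Bool; true; false; if_then_else_; _∧_)
open import Data.List using (List; []; _∷_; concatMap)
open import Data.Bool.ListAction using (any)
open import Data.Fin.Base using ()
open import Data.List.Base using ()
open import Data.Product using (_×_; _,_; ∃; ∃-syntax)
open import Data.List.Membership.Propositional using (_∈_)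
open import Relation.Binary.PropositionalEquality using (_≡_)

open import Data.List using (allFin) public

Adj : ℕ → Set
Adj N = Fin N → Fin N → Bool

IsUndirected : {N : ℕ} → Adj N → Set
IsUndirected {N} adj = (u v : Fin N) → adj u v ≡ adj v u

IsLoopless : {N : ℕ} → Adj N → Set
IsLoopless {N} adj = (u : Fin N) → adj u u ≡ false

data Walk {N : ℕ} (adj : Adj N) : Fin N → Fin N → ℕ → Set where
  here : ∀ {u} → Walk adj u u 0
  step : ∀ {u w v k} → adj u w ≡ true → Walk adj w v k → Walk adj u v (suc k)

IsConnected : {N : ℕ} → Adj N → Set
IsConnected {N} adj = (u v : Fin N) → ∃[ k ] Walk adj u v k

IsDist : {N : ℕ} → Adj N → Fin N → Fin N → ℕ → Set
IsDist adj u v d = Walk adj u v d × (∀ k → Walk adj u v k → d ≤ k)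

OnShortestPath : {N : ℕ} → Adj N → Fin N → Fin N → Fin N → Set
OnShortestPath adj u x w =
  ∃[ a ] ∃[ b ] (IsDist adj u x a × IsDist adj x w b × IsDist adj u w (a + b))

-- visit status of a vertex during one pruned BFS:
-- unvisited, visited at depth d and in Q_label, visited at depth d and in Q_prune
data Status : Set where
  unvisited : Status
  inLabel   : ℕ → Status
  inPrune   : ℕ → Status

isUnvisited : Status → Bool
isUnvisited unvisited = true
isUnvisited _         = false

isLabelAt : ℕ → Status → Bool
isLabelAt n (inLabel m) = n ≡ᵇ m
isLabelAt n _           = false

isPruneAt : ℕ → Status → Bool
isPruneAt n (inPrune m) = n ≡ᵇ m
isPruneAt n _           = false

module Algorithm1 {N : ℕ} (adj : Adj N) (inR : Fin N → Bool) where

  State : Set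
  State = Fin N → Status

  hasNbr : State → (Status → Bool) → Fin N → Bool
  hasNbr s p v = any (λ u → adj u v ∧ p (s u)) (allFin N)

  expandLabel : ℕ → State → State
  expandLabel n s v =
    if isUnvisited (s v) ∧ hasNbr s (isLabelAt n) v
    then (if inR v then inPrune (suc n) else inLabel (suc n))
    else s v

  -- step (iii) (after n ← n+1): expand prune queue at depth n+1
  expandPrune : ℕ → State → State
  expandPrune n s v =
    if isUnvisited (s v) ∧ hasNbr s (isPruneAt (suc n)) v
    then inPrune (suc (suc n))
    else s v

  iteration : ℕ → State → State
  iteration n s = expandPrune n (expandLabel n s)

  -- while Q_label contains vertices of depth n: iterate.
  -- The fuel suc N is never exhausted (depth of a label vertex is < N).
  loop : ℕ → ℕ → State → State
  loop zero     n s = s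
  loop (suc f) n s =
    if any (λ v → isLabelAt n (s v)) (allFin N)
    then loop f (suc n) (iteration n s)
    else s

  initial : Fin N → State
  initial r v = if toℕ r ≡ᵇ toℕ v then inLabel 0 else unvisited

  bfs : Fin N → State
  bfs r = loop (suc N) 0 (initial r)

  entry : Fin N → Status → List (Fin N × ℕ)
  entry r (inLabel d) = (r , d) ∷ []
  entry r _           = []

  -- the labelling L output by Algorithm 1 (roots processed in the order of Fin N;
  -- as a set of entries the result does not depend on the order)
  L : Fin N → List (Fin N × ℕ)
  L v = concatMap (λ r → if inR r then entry r (bfs r v) else []) (allFin N)

IsDistanceLabelling : {N : ℕ} → Adj N → (Fin N → Bool) → (Fin N → List (Fin N × ℕ)) → Set
IsDistanceLabelling {N} adj inR L =
  (v : Fin N) → inR v ≡ false →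
  (r : Fin N) (δ : ℕ) → (r , δ) ∈ L v → inR r ≡ true × IsDist adj r v δ

HighwayCover : {N : ℕ} → Adj N → (Fin N → Bool) → (Fin N → List (Fin N × ℕ)) → Set
HighwayCover {N} adj inR L =
  (s t : Fin N) → inR s ≡ false → inR t ≡ false →
  (r : Fin N) → inR r ≡ true →
    (∃[ ri ] ∃[ δi ] ((ri , δi) ∈ L s × OnShortestPath adj r ri s))
  × (∃[ rj ] ∃[ δj ] ((rj , δj) ∈ L t × OnShortestPath adj r rj t))

module Submission where

-- Fix a landmark r and write sₙ for the BFS state after n iterations of the
-- loop.  By induction on n, sₙ satisfies an invariant (record Inv):
--   * a vertex labelled at depth d is at distance d from r;
--   * a vertex pruned at depth d is at distance d from r, and some landmark
--     y ≠ r lies on a shortest r–v path (a "bypass");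
--   * every vertex within distance n of r is visited;
--   * out-neighbours of vertices pruned at depth ≤ n are visited.  The loop stops at a state sₘ
-- with no vertex labelled at depth m (the fuel cannot run out, since every
-- distance is < N), and from this every vertex v at distance D from r either
-- received the entry (r , D) or has a bypass.
-- The distance-labelling property is then the first clause of the invariant,
-- and the highway cover property follows by strong induction on d(r,s): either
-- (r , d(r,s)) ∈ L(s), or a landmark y ≠ r on a shortest r–s path is strictly
-- closer to s, and a covering entry for (y , s) also covers (r , s).

open import Defs
open import Data.Nat using (ℕ; zero; suc; _+_; _≤_; _<_; _≡ᵇ_; z≤n; s≤s; _≤?_)
open import Data.Nat.Properties
open import Data.Nat.Induction using (<-rec)
open import Data.Fin using (Fin; toℕ)
open import Data.Fin.Properties using (toℕ-injective; pigeonhole; any?; toℕ≤pred[n])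
  renaming (_≟_ to _≟F_)
open import Data.Bool using (Bool; true; false; if_then_else_; _∧_)
open import Data.Bool.Properties using (T-≡; ∧-conicalˡ; ∧-conicalʳ) renaming (_≟_ to _≟B_)
open import Data.Bool.ListAction using (any)
open import Data.List using (List; []; allFin)
open import Data.List.Membership.Propositional using (_∈_; lose)
open import Data.List.Membership.Propositional.Properties using (∈-allFin; ∈-concatMap⁺; ∈-concatMap⁻)
open import Data.List.Relation.Unary.Any using (here; there; satisfied)
open import Data.List.Relation.Unary.Any.Properties using (any⁺; any⁻)
open import Data.Product
open import Data.Sum using (_⊎_; inj₁; inj₂)
import Data.Sum as Sum
open import Data.Empty using (⊥; ⊥-elim)
open import Function using (_∘_; Equivalence)
open import Relation.Nullary using (Dec; yes; no)
open import Relation.Binary.PropositionalEquality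

open Equivalence using (to; from)

≡ᵇ-sound : ∀ m n → (m ≡ᵇ n) ≡ true → m ≡ n
≡ᵇ-sound m n e = ≡ᵇ⇒≡ m n (from T-≡ e)

≡ᵇ-refl : ∀ n → (n ≡ᵇ n) ≡ true
≡ᵇ-refl n = to T-≡ (≡⇒≡ᵇ n n refl)

any-witness : ∀ {A : Set} (p : A → Bool) xs → any p xs ≡ true → ∃ λ x → p x ≡ true
any-witness p xs e = map₂ (to T-≡) (satisfied (any⁻ p xs (from T-≡ e)))

any-intro : ∀ {A : Set} (p : A → Bool) {xs x} → x ∈ xs → p x ≡ true → any p xs ≡ true
any-intro p x∈xs e = to T-≡ (any⁺ p (lose x∈xs (from T-≡ e)))

any-false : ∀ {A : Set} (p : A → Bool) {xs x} → x ∈ xs → any p xs ≡ false → p x ≡ false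
any-false p {x = x} x∈xs e with p x in px
... | false = refl
... | true with () ← trans (sym (any-intro p x∈xs px)) e

least : (P : ℕ → Set) → (∀ j → Dec (P j)) → ∀ k → P k →
        ∃ λ D → P D × (∀ j → P j → D ≤ j)
least P dec zero p = 0 , p , λ _ _ → z≤n
least P dec (suc k) p with dec 0
... | yes p0 = 0 , p0 , λ _ _ → z≤n
... | no ¬p0 with least (P ∘ suc) (dec ∘ suc) k p
... | D , pD , minD = suc D , pD , λ { zero p0 → ⊥-elim (¬p0 p0) ; (suc j) pj → s≤s (minD j pj) }

module Distances {N : ℕ} (adj : Adj N) where

  snoc : ∀ {u w v k} → Walk adj u w k → adj w v ≡ true → Walk adj u v (suc k)
  snoc here e = step e here
  snoc (step e' p) e = step e' (snoc p e)

  unsnoc : ∀ {u v k} → Walk adj u v (suc k) → ∃ λ w → Walk adj u w k × adj w v ≡ true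
  unsnoc (step e here) = _ , here , e
  unsnoc (step e (step e' p)) with unsnoc (step e' p)
  ... | x , px , ex = x , step e px , ex

  append : ∀ {u w v a b} → Walk adj u w a → Walk adj w v b → Walk adj u v (a + b)
  append here q = q
  append (step e p) q = step e (append p q)

  dist-unique : ∀ {u v a b} → IsDist adj u v a → IsDist adj u v b → a ≡ b
  dist-unique A B = ≤-antisym (proj₂ A _ (proj₁ B)) (proj₂ B _ (proj₁ A))

  dist-refl : ∀ {u} → IsDist adj u u 0
  dist-refl = here , λ _ _ → z≤n

  dist-pred : ∀ {r v D} → IsDist adj r v (suc D) → ∃ λ w → IsDist adj r w D × adj w v ≡ true
  dist-pred (p , minp) with unsnoc p
  ... | w , pw , e = w , (pw , λ k q → ≤-pred (minp (suc k) (snoc q e))) , e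

  dist-suc : ∀ {r u v m} → IsDist adj r u m → adj u v ≡ true →
             (∀ k → Walk adj r v k → k ≤ m → ⊥) → IsDist adj r v (suc m)
  dist-suc {m = m} du e far = snoc (proj₁ du) e , minimal
    where
    minimal : ∀ k → Walk adj _ _ k → suc m ≤ k
    minimal k p with suc m ≤? k
    ... | yes m<k = m<k
    ... | no m≮k = ⊥-elim (far k p (≤-pred (≰⇒> m≮k)))

  dist-split : ∀ {r y v a b} → IsDist adj r v (a + b) → Walk adj r y a → Walk adj y v b →
               IsDist adj r y a × IsDist adj y v b
  dist-split {a = a} {b} drv p q =
    (p , λ k p' → +-cancelʳ-≤ b a k (proj₂ drv _ (append p' q))) ,
    (q , λ k q' → +-cancelˡ-≤ a b k (proj₂ drv _ (append p q')))

  walk? : ∀ k u v → Dec (Walk adj u v k)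
  walk? zero u v with u ≟F v
  ... | yes refl = yes here
  ... | no u≢v = no λ { here → u≢v refl }
  walk? (suc k) u v with any? firstStep?
    where
    firstStep? : ∀ w → Dec (adj u w ≡ true × Walk adj w v k)
    firstStep? w with adj u w ≟B true | walk? k w v
    ... | yes e | yes p = yes (e , p)
    ... | no ¬e | _ = no (¬e ∘ proj₁)
    ... | _ | no ¬p = no (¬p ∘ proj₂)
  ... | yes (w , e , p) = yes (step e p)
  ... | no ¬first = no λ { (step e p) → ¬first (_ , e , p) }

  dist-exists : ∀ {u v k} → Walk adj u v k → ∃ λ D → IsDist adj u v D
  dist-exists {u} {v} {k} p = least (λ j → Walk adj u v j) (λ j → walk? j u v) k p

  dist-prefix : ∀ {r v} D → IsDist adj r v D → ∀ i → i ≤ D → ∃ λ u → IsDist adj r u i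
  dist-prefix zero d .zero z≤n = _ , d
  dist-prefix (suc D) d i i≤D with m≤n⇒m<n∨m≡n i≤D
  ... | inj₂ refl = _ , d
  ... | inj₁ i<D = dist-prefix D (proj₁ (proj₂ (dist-pred d))) i (≤-pred i<D)

  -- Distances are smaller than the number of vertices: the D+1 vertices at
  -- distances 0..D along a shortest walk are distinct.
  dist<N : ∀ {r v D} → IsDist adj r v D → D < N
  dist<N {r} {v} {D} d with N ≤? D
  ... | no N≰D = ≰⇒> N≰D
  ... | yes N≤D with pigeonhole (s≤s N≤D) atDist
    where
    atDist : Fin (suc D) → Fin N
    atDist i = proj₁ (dist-prefix D d (toℕ i) (toℕ≤pred[n] i))
  ... | i , j , i<j , same = ⊥-elim (<-irrefl (dist-unique (subst (λ u → IsDist adj r u (toℕ i)) same di) dj) i<j)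
    where
    di = proj₂ (dist-prefix D d (toℕ i) (toℕ≤pred[n] i))
    dj = proj₂ (dist-prefix D d (toℕ j) (toℕ≤pred[n] j))

update-keeps : (x : Status) {b : Bool} {y : Status} → isUnvisited x ≡ false →
               (if isUnvisited x ∧ b then y else x) ≡ x
update-keeps unvisited ()
update-keeps (inLabel _) _ = refl
update-keeps (inPrune _) _ = refl

update-visits : (x : Status) {b : Bool} {y : Status} → b ≡ true → isUnvisited y ≡ false →
                isUnvisited (if isUnvisited x ∧ b then y else x) ≡ false
update-visits unvisited refl vy = vy
update-visits (inLabel _) _ _ = refl
update-visits (inPrune _) _ _ = refl

update-cases : (x : Status) (b : Bool) (y : Status) →
  ((if isUnvisited x ∧ b then y else x) ≡ x) ⊎
  (x ≡ unvisited × b ≡ true × (if isUnvisited x ∧ b then y else x) ≡ y)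
update-cases unvisited true y = inj₂ (refl , refl , refl)
update-cases unvisited false y = inj₁ refl
update-cases (inLabel _) b y = inj₁ refl
update-cases (inPrune _) b y = inj₁ refl

unvisited-not-visited : ∀ {st} → st ≡ unvisited → isUnvisited st ≡ false → ⊥
unvisited-not-visited refl ()

isLabelAt-sound : ∀ n st → isLabelAt n st ≡ true → st ≡ inLabel n
isLabelAt-sound n unvisited ()
isLabelAt-sound n (inLabel m) e = cong inLabel (sym (≡ᵇ-sound n m e))
isLabelAt-sound n (inPrune _) ()

isLabelAt-false : ∀ n {st} → isLabelAt n st ≡ false → st ≢ inLabel n
isLabelAt-false n e refl with () ← trans (sym (≡ᵇ-refl n)) e

isPruneAt-sound : ∀ n st → isPruneAt n st ≡ true → st ≡ inPrune n
isPruneAt-sound n unvisited ()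
isPruneAt-sound n (inLabel _) ()
isPruneAt-sound n (inPrune m) e = cong inPrune (sym (≡ᵇ-sound n m e))

discovered-cases : ∀ (b : Bool) {m st} → (if b then inPrune m else inLabel m) ≡ st →
                   (b ≡ true × st ≡ inPrune m) ⊎ (b ≡ false × st ≡ inLabel m)
discovered-cases true refl = inj₁ (refl , refl)
discovered-cases false refl = inj₂ (refl , refl)

discovered-visited : ∀ (b : Bool) {m} → isUnvisited (if b then inPrune m else inLabel m) ≡ false
discovered-visited true = refl
discovered-visited false = refl

module PrunedBFS {N : ℕ} (adj : Adj N) (inR : Fin N → Bool) (r : Fin N) where
  open Algorithm1 adj inR
  open Distances adj

  Visited : State → Fin N → Set
  Visited s v = isUnvisited (s v) ≡ false

  -- A shortest r–v path of length d passes through a landmark y ≠ r.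
  Bypass : Fin N → ℕ → Set
  Bypass v d = Σ (Fin N) λ y → Σ ℕ λ a → Σ ℕ λ b →
    inR y ≡ true × IsDist adj r y (suc a) × IsDist adj y v b × suc a + b ≡ d

  bypass-extend : ∀ {u v m} → Bypass u m → IsDist adj r v (suc m) → adj u v ≡ true → Bypass v (suc m)
  bypass-extend {u} {v} {m} (y , a , b , y∈R , dy , dyu , len) dv e =
    y , a , suc b , y∈R , dy , proj₂ (dist-split (subst (IsDist adj r v) (sym len') dv) (proj₁ dy) (snoc (proj₁ dyu) e)) , len'
    where
    len' : suc a + suc b ≡ suc m
    len' = trans (+-suc (suc a) b) (cong suc len)

  hasNbr-witness : ∀ s p v → hasNbr s p v ≡ true → ∃ λ u → adj u v ≡ true × p (s u) ≡ true
  hasNbr-witness s p v e with any-witness (λ u → adj u v ∧ p (s u)) (allFin N) e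
  ... | u , eu = u , ∧-conicalˡ _ _ eu , ∧-conicalʳ _ _ eu

  hasNbr-intro : ∀ s p v u → adj u v ≡ true → p (s u) ≡ true → hasNbr s p v ≡ true
  hasNbr-intro s p v u e1 e2 = any-intro (λ u → adj u v ∧ p (s u)) (∈-allFin u) (cong₂ _∧_ e1 e2)

  -- The invariant, with separate bounds for labelled depths, the visited ball
  -- and the closed pruned depths, so that both half-steps can be described.
  record Inv (s : State) (nl nc np : ℕ) : Set where
    field
      labelled-dist : ∀ v d → s v ≡ inLabel d → d ≤ nl × IsDist adj r v d
      pruned-dist   : ∀ v d → s v ≡ inPrune d → IsDist adj r v d × Bypass v d
      ball-visited  : ∀ v k → Walk adj r v k → k ≤ nc → Visited s v
      pruned-closed : ∀ u v k → s u ≡ inPrune k → k ≤ np → adj u v ≡ true → Visited s v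

  visited-depth : ∀ {s nl nc np x} → Inv s nl nc np → Visited s x →
                  ∃ λ d → IsDist adj r x d × (s x ≡ inLabel d ⊎ s x ≡ inPrune d)
  visited-depth {s} {x = x} I vx with s x in e
  ... | unvisited with () ← vx
  ... | inLabel d = d , proj₂ (Inv.labelled-dist I x d e) , inj₁ refl
  ... | inPrune d = d , proj₁ (Inv.pruned-dist I x d e) , inj₂ refl

  inv-initial : Inv (initial r) 0 0 0
  inv-initial = record { labelled-dist = lab ; pruned-dist = pru ; ball-visited = ball ; pruned-closed = closed }
    where
    lab : ∀ v d → initial r v ≡ inLabel d → d ≤ 0 × IsDist adj r v d
    lab v d e with toℕ r ≡ᵇ toℕ v in root
    lab v d refl | true with refl ← toℕ-injective {i = r} {j = v} (≡ᵇ-sound _ _ root) = z≤n , dist-refl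
    lab v d () | false
    pru : ∀ v d → initial r v ≡ inPrune d → IsDist adj r v d × Bypass v d
    pru v d e with toℕ r ≡ᵇ toℕ v
    pru v d () | true
    pru v d () | false
    ball : ∀ v k → Walk adj r v k → k ≤ 0 → Visited (initial r) v
    ball v .zero here z≤n rewrite ≡ᵇ-refl (toℕ r) = refl
    closed : ∀ u v k → initial r u ≡ inPrune k → k ≤ 0 → adj u v ≡ true → Visited (initial r) v
    closed u v k e with toℕ r ≡ᵇ toℕ u
    closed u v k () | true
    closed u v k () | false

  module LabelStep (n : ℕ) (s : State) (I : Inv s n n n) where
    open Inv I
    s' : State
    s' = expandLabel n s

    keeps : ∀ v → Visited s v → Visited s' v
    keeps v h = trans (cong isUnvisited (update-keeps (s v) h)) h

    cases : ∀ v → (s' v ≡ s v) ⊎ (s v ≡ unvisited × hasNbr s (isLabelAt n) v ≡ true ×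
                                   s' v ≡ (if inR v then inPrune (suc n) else inLabel (suc n)))
    cases v = update-cases (s v) (hasNbr s (isLabelAt n) v) (if inR v then inPrune (suc n) else inLabel (suc n))

    discovered-dist : ∀ v → s v ≡ unvisited → hasNbr s (isLabelAt n) v ≡ true → IsDist adj r v (suc n)
    discovered-dist v sv h with hasNbr-witness s (isLabelAt n) v h
    ... | u , uv , lu = dist-suc (proj₂ (labelled-dist u n (isLabelAt-sound n (s u) lu))) uv
                          (λ k p k≤n → unvisited-not-visited sv (ball-visited v k p k≤n))

    labelled-dist' : ∀ v d → s' v ≡ inLabel d → d ≤ suc n × IsDist adj r v d
    labelled-dist' v d e with cases v
    ... | inj₁ same = map₁ m≤n⇒m≤1+n (labelled-dist v d (trans (sym same) e))
    ... | inj₂ (sv , h , new) with discovered-cases (inR v) (trans (sym new) e)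
    ... | inj₁ (_ , ())
    ... | inj₂ (_ , refl) = ≤-refl , discovered-dist v sv h

    pruned-dist' : ∀ v d → s' v ≡ inPrune d → IsDist adj r v d × Bypass v d
    pruned-dist' v d e with cases v
    ... | inj₁ same = pruned-dist v d (trans (sym same) e)
    ... | inj₂ (sv , h , new) with discovered-cases (inR v) (trans (sym new) e)
    ... | inj₂ (_ , ())
    ... | inj₁ (v∈R , refl) = dv , v , n , 0 , v∈R , dv , dist-refl , +-identityʳ (suc n)
      where dv = discovered-dist v sv h

    label-expands : ∀ x v → s x ≡ inLabel n → adj x v ≡ true → Visited s' v
    label-expands x v lx xv = update-visits (s v)
      (hasNbr-intro s (isLabelAt n) v x xv (subst (λ st → isLabelAt n st ≡ true) (sym lx) (≡ᵇ-refl n)))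
      (discovered-visited (inR v))

    -- A vertex at distance n+1 has a visited in-neighbour x at distance ≤ n;
    -- it was visited before if d(r,x) < n, by pruned-closed if x was pruned
    -- at depth n, and by this step if x was labelled at depth n.
    ball-visited' : ∀ v k → Walk adj r v k → k ≤ suc n → Visited s' v
    ball-visited' v k p k≤ with m≤n⇒m<n∨m≡n k≤
    ... | inj₁ k<  = keeps v (ball-visited v k p (≤-pred k<))
    ... | inj₂ refl with unsnoc p
    ... | x , px , xv with visited-depth I (ball-visited x n px ≤-refl)
    ... | d , dx , sx with m≤n⇒m<n∨m≡n (proj₂ dx n px)
    ... | inj₁ d<n = keeps v (ball-visited v (suc d) (snoc (proj₁ dx) xv) d<n)
    ... | inj₂ refl with sx
    ... | inj₁ lx = label-expands x v lx xv
    ... | inj₂ px' = keeps v (pruned-closed x v d px' ≤-refl xv)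

    pruned-closed' : ∀ u v k → s' u ≡ inPrune k → k ≤ n → adj u v ≡ true → Visited s' v
    pruned-closed' u v k e k≤n uv with cases u
    ... | inj₁ same = keeps v (pruned-closed u v k (trans (sym same) e) k≤n uv)
    ... | inj₂ (_ , _ , new) with discovered-cases (inR u) (trans (sym new) e)
    ... | inj₂ (_ , ())
    ... | inj₁ (_ , refl) = ⊥-elim (<-irrefl refl k≤n)

    inv : Inv s' (suc n) (suc n) n
    inv = record { labelled-dist = labelled-dist' ; pruned-dist = pruned-dist'
                 ; ball-visited = ball-visited' ; pruned-closed = pruned-closed' }

  module PruneStep (n : ℕ) (s : State) (I : Inv s (suc n) (suc n) n) where
    open Inv I
    s' : State
    s' = expandPrune n s

    keeps : ∀ v → Visited s v → Visited s' v
    keeps v h = trans (cong isUnvisited (update-keeps (s v) h)) h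

    cases : ∀ v → (s' v ≡ s v) ⊎ (s v ≡ unvisited × hasNbr s (isPruneAt (suc n)) v ≡ true ×
                                   s' v ≡ inPrune (suc (suc n)))
    cases v = update-cases (s v) (hasNbr s (isPruneAt (suc n)) v) (inPrune (suc (suc n)))

    labelled-dist' : ∀ v d → s' v ≡ inLabel d → d ≤ suc n × IsDist adj r v d
    labelled-dist' v d e with cases v
    ... | inj₁ same = labelled-dist v d (trans (sym same) e)
    ... | inj₂ (_ , _ , new) with () ← trans (sym new) e

    -- A newly pruned vertex is one step behind a pruned vertex, whose bypass it inherits.
    pruned-dist' : ∀ v d → s' v ≡ inPrune d → IsDist adj r v d × Bypass v d
    pruned-dist' v d e with cases v
    ... | inj₁ same = pruned-dist v d (trans (sym same) e)
    ... | inj₂ (sv , h , new) with trans (sym new) e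
    ... | refl with hasNbr-witness s (isPruneAt (suc n)) v h
    ... | u , uv , pu with pruned-dist u (suc n) (isPruneAt-sound (suc n) (s u) pu)
    ... | du , bu = dv , bypass-extend bu dv uv
      where
      dv = dist-suc du uv (λ k p k≤ → unvisited-not-visited sv (ball-visited v k p k≤))

    ball-visited' : ∀ v k → Walk adj r v k → k ≤ suc n → Visited s' v
    ball-visited' v k p k≤ = keeps v (ball-visited v k p k≤)

    pruned-closed' : ∀ u v k → s' u ≡ inPrune k → k ≤ suc n → adj u v ≡ true → Visited s' v
    pruned-closed' u v k e k≤ uv with cases u
    ... | inj₂ (_ , _ , new) with trans (sym new) e
    ... | refl = ⊥-elim (<-irrefl refl k≤)
    pruned-closed' u v k e k≤ uv | inj₁ same with m≤n⇒m<n∨m≡n k≤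
    ... | inj₁ k< = keeps v (pruned-closed u v k (trans (sym same) e) (≤-pred k<) uv)
    ... | inj₂ refl = update-visits (s v)
            (hasNbr-intro s (isPruneAt (suc n)) v u uv
              (subst (λ st → isPruneAt (suc n) st ≡ true) (sym (trans (sym same) e)) (≡ᵇ-refl n)))
            refl

    inv : Inv s' (suc n) (suc n) (suc n)
    inv = record { labelled-dist = labelled-dist' ; pruned-dist = pruned-dist'
                 ; ball-visited = ball-visited' ; pruned-closed = pruned-closed' }

  stateAt : ℕ → State
  stateAt zero = initial r
  stateAt (suc n) = iteration n (stateAt n)

  inv-stateAt : ∀ n → Inv (stateAt n) n n n
  inv-stateAt zero = inv-initial
  inv-stateAt (suc n) = PruneStep.inv n _ (LabelStep.inv n (stateAt n) (inv-stateAt n))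

  NoLabelAt : ℕ → Set
  NoLabelAt m = ∀ v → stateAt m v ≢ inLabel m

  loop-result : ∀ f n → ∃ λ m → loop f n (stateAt n) ≡ stateAt m × (NoLabelAt m ⊎ n + f ≤ m)
  loop-result zero n = n , refl , inj₂ (≤-reflexive (+-identityʳ n))
  loop-result (suc f) n with any (λ v → isLabelAt n (stateAt n v)) (allFin N) in e
  ... | true with loop-result f (suc n)
  ...   | m , ends , stop = m , ends , Sum.map₂ (subst (_≤ m) (sym (+-suc n f))) stop
  loop-result (suc f) n | false =
    n , refl , inj₁ (λ v → isLabelAt-false n (any-false (λ v → isLabelAt n (stateAt n v)) (∈-allFin v) e))

  -- Labels have depth < N, so the label queue is empty from depth N on.
  noLabel-beyond : ∀ m → N ≤ m → NoLabelAt m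
  noLabel-beyond m N≤m v lv = <⇒≱ (dist<N (proj₂ (Inv.labelled-dist (inv-stateAt m) v m lv))) N≤m

  bfs-stops : ∃ λ m → bfs r ≡ stateAt m × NoLabelAt m
  bfs-stops with loop-result (suc N) 0
  ... | m , ends , inj₁ free = m , ends , free
  ... | m , ends , inj₂ fuel = m , ends , noLabel-beyond m (≤-trans (n≤1+n N) fuel)

  module Final (m : ℕ) (free : NoLabelAt m) where
    open Inv (inv-stateAt m)

    covered : ∀ D v → IsDist adj r v D → stateAt m v ≡ inLabel D ⊎ Bypass v D
    unvisited-bypass : ∀ D v → IsDist adj r v D → stateAt m v ≡ unvisited → Bypass v D

    covered D v dv with stateAt m v in e
    ... | inLabel d = inj₁ (cong inLabel (dist-unique (proj₂ (labelled-dist v d e)) dv))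
    ... | inPrune d = inj₂ (subst (Bypass v) (dist-unique (proj₁ (pruned-dist v d e)) dv) (proj₂ (pruned-dist v d e)))
    ... | unvisited = inj₂ (unvisited-bypass D v dv e)

    -- An unvisited vertex lies beyond depth m; its predecessor on a shortest
    -- path cannot be labelled (no labels at depth m), so it has a bypass.
    unvisited-bypass D v dv e with D ≤? m
    ... | yes D≤m = ⊥-elim (unvisited-not-visited e (ball-visited v D (proj₁ dv) D≤m))
    unvisited-bypass zero v dv e | no D≰m = ⊥-elim (D≰m z≤n)
    unvisited-bypass (suc D) v dv e | no D≰m with dist-pred dv
    ... | w , dw , wv with covered D w dw
    ... | inj₂ bw = bypass-extend bw dv wv
    ... | inj₁ lw with ≤-antisym (proj₁ (labelled-dist w D lw)) (≤-pred (≰⇒> D≰m))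
    ... | refl = ⊥-elim (free w lw)

  bfs-covers : ∀ D v → IsDist adj r v D → bfs r v ≡ inLabel D ⊎ Bypass v D
  bfs-covers D v dv with bfs-stops
  ... | m , ends , free = Sum.map₁ (trans (cong (λ s → s v) ends)) (Final.covered m free D v dv)

  bfs-sound : ∀ v d → bfs r v ≡ inLabel d → IsDist adj r v d
  bfs-sound v d e with bfs-stops
  ... | m , ends , _ = proj₂ (Inv.labelled-dist (inv-stateAt m) v d (trans (sym (cong (λ s → s v) ends)) e))

module Labelling {N : ℕ} (adj : Adj N) (inR : Fin N → Bool) where
  open Algorithm1 adj inR
  open Distances adj
  open PrunedBFS adj inR using (bfs-sound; bfs-covers)

  contribution : Fin N → Fin N → List (Fin N × ℕ)
  contribution v x = if inR x then entry x (bfs x v) else []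

  contribution-member : ∀ x v r δ → (r , δ) ∈ contribution v x →
                        inR x ≡ true × r ≡ x × bfs x v ≡ inLabel δ
  contribution-member x v r δ m with inR x | bfs x v
  contribution-member x v r δ (here refl) | true | inLabel d = refl , refl , refl
  contribution-member x v r δ (there ()) | true | inLabel d
  contribution-member x v r δ () | true | unvisited
  contribution-member x v r δ () | true | inPrune _
  contribution-member x v r δ () | false | _

  label-member : ∀ x v d → inR x ≡ true → bfs x v ≡ inLabel d → (x , d) ∈ L v
  label-member x v d x∈R lv = ∈-concatMap⁺ (contribution v) (lose (∈-allFin x) entry-present)
    where
    entry-present : (x , d) ∈ contribution v x
    entry-present rewrite x∈R | lv = here refl

  distance-labelling : IsDistanceLabelling adj inR L
  distance-labelling v _ r δ m with satisfied (∈-concatMap⁻ (contribution v) {xs = allFin N} m)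
  ... | x , mx with contribution-member x v r δ mx
  ... | x∈R , refl , lv = x∈R , bfs-sound r v δ lv

  Covers : Fin N → Fin N → Set
  Covers r s = ∃[ ri ] ∃[ δ ] ((ri , δ) ∈ L s × OnShortestPath adj r ri s)

  -- Strong induction on D = d(r,s): either (r , D) ∈ L(s), or a bypass
  -- landmark y is strictly closer to s, and the entry covering (y , s) lies on
  -- a shortest y–s path, hence on a shortest r–s path through y.
  covers : ∀ D r s → inR r ≡ true → IsDist adj r s D → Covers r s
  covers = <-rec _ cover-step
    where
    cover-step : ∀ D → (∀ {D'} → D' < D → ∀ r s → inR r ≡ true → IsDist adj r s D' → Covers r s) →
                 ∀ r s → inR r ≡ true → IsDist adj r s D → Covers r s
    cover-step D ih r s r∈R ds with bfs-covers r D s ds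
    ... | inj₁ ls = r , D , label-member r s D r∈R ls , 0 , D , dist-refl , ds , ds
    ... | inj₂ (y , a , b , y∈R , dry , dys , len)
      with ih (subst (b <_) len (m<n+m b (s≤s z≤n))) y s y∈R dys
    ... | ri , δ , mem , a' , b' , dyri , dris , dys' = ri , δ , mem , suc a + a' , b' , drri , dris , drs
      where
      total : D ≡ (suc a + a') + b'
      total = trans (sym len) (trans (cong (suc a +_) (dist-unique dys dys')) (sym (+-assoc (suc a) a' b')))
      drs : IsDist adj r s ((suc a + a') + b')
      drs = subst (IsDist adj r s) total ds
      drri : IsDist adj r ri (suc a + a')
      drri = proj₁ (dist-split drs (append (proj₁ dry) (proj₁ dyri)) (proj₁ dris))

  highway-cover : IsConnected adj → HighwayCover adj inR L
  highway-cover conn s t _ _ r r∈R = cover s , cover t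
    where
    cover : ∀ x → Covers r x
    cover x = let (D , dx) = dist-exists (proj₂ (conn r x)) in covers D r x r∈R dx

theorem3p9 : (N : ℕ) (adj : Adj N) (inR : Fin N → Bool) →
    IsUndirected adj → IsLoopless adj → IsConnected adj →
    IsDistanceLabelling adj inR (Algorithm1.L adj inR)
      × HighwayCover adj inR (Algorithm1.L adj inR)
theorem3p9 N adj inR _ _ conn = distance-labelling , highway-cover conn
  where open Labelling adj inR
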